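{- Let $pX$ be a process of a visibly pushdown automaton and let $\equiv$ be any equivalence relation lying between bisimilarity and trace equivalence (i.e. $s\sim t$ implies $s\equiv t$, and $s\equiv t$ implies $s$ and $t$ are trace equivalent). Then $pX$ provides unbounded popping if and only if $pX$ is not regular with respect to $\equiv$.
   Context: A pushdown automaton over finite action set $\mathit{Act}$, stack alphabet $\Gamma$, control states $Q$ is a finite set of rules $pX\xrightarrow{a}q\alpha$ ($p,q\in Q$, $X\in\Gamma$, $\alpha\in\Gamma^*$), generating the labelled transition system on configurations $p\alpha\in Q\times\Gamma^*$ (top of stack leftmost) with $pX\gamma\xrightarrow{a}q\alpha\gamma$ for each rule and each $\gamma\in\Gamma^*$. It is a visibly pushdown automaton (vPDA) if $\mathit{Act}$ is partitioned into call, return, internal actions $\mathit{Act}_c,\mathit{Act}_r,\mathit{Act}_i$ and each rule $pX\xrightarrow{a}q\alpha$ has $|\alpha|=2,0,1$ for $a\in\mathit{Act}_c,\mathit{Act}_r,\mathit{Act}_i$ respectively. A process $pX$ is a configuration with one stack symbol. Define $h(a)=+1$ for $a\in\mathit{Act}_c$, $h(a)=-1$ for $a\in\mathit{Act}_r$, $h(a)=0$ for $a\in\mathit{Act}_i$, extended additively to words. $pX$ provides unbounded popping if for every natural number $d$ there exist a configuration $q\beta$ and a word $w\in\mathit{Act}^*$ with $h(w)\le -d$, $pX\to^* q\beta$, and $w$ executable from $q\beta$. Two states are trace equivalent iff they have the same set of traces $\{w\mid \exists s'.\,s\xrightarrow{w}s'\}$. Bisimilarity $\sim$: $s\sim t$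 iff some relation $R\ni(s,t)$ with $R=R^{ -1}$ satisfies: for all $(s,t)\in R$ and $s\xrightarrow{a}s'$ there is $t\xrightarrow{a}t'$ with $(s',t')\in R$. States of different systems are compared in their disjoint union. $pX$ is regular w.r.t. $\equiv$ iff there is a state $F$ of a finite labelled transition system with $pX\equiv F$. -}

module Defs where

open import Level using (Level)
open import Data.Nat using (ℕ)
open import Data.Fin using (Fin)
open import Data.Bool using (Bool; T)
open import Data.Empty using (⊥)
open import Data.List using (List; []; _∷_; _++_; length)
open import Data.List.Membership.Propositional using (_∈_)
open import Data.List.Relation.Unary.All using (All)
open import Data.Integer using (ℤ; -_; +_; _≤_) renaming (_+_ to _+ℤ_)
open import Data.Product using (Σ; ∃; _×_; _,_)
open import Data.Sum using (_⊎_; inj₁; inj₂)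
open import Relation.Binary.PropositionalEquality using (_≡_)
open import Relation.Nullary using (¬_)

record LTS (A : Set) : Set₁ where
  field
    State  : Set
    _⟶[_]_ : State → A → State → Set
open LTS public

Pointed : Set → Set₁
Pointed A = Σ (LTS A) State

data Steps {A : Set} (L : LTS A) : State L → List A → State L → Set where
  done : ∀ {s} → Steps L s [] s
  step : ∀ {s a s' w s''} → LTS._⟶[_]_ L s a s' → Steps L s' w s'' → Steps L s (a ∷ w) s''

IsTrace : {A : Set} (L : LTS A) → State L → List A → Set
IsTrace L s w = ∃ λ s' → Steps L s w s'

Reach : {A : Set} (L : LTS A) → State L → State L → Set
Reach L s s' = ∃ λ w → Steps L s w s'

TraceEquivalent : {A : Set} → Pointed A → Pointed A → Set
TraceEquivalent (L₁ , s) (L₂ , t) =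
  ∀ w → (IsTrace L₁ s w → IsTrace L₂ t w) × (IsTrace L₂ t w → IsTrace L₁ s w)

_⊎L_ : {A : Set} → LTS A → LTS A → LTS A
_⊎L_ {A} L₁ L₂ = record { State = State L₁ ⊎ State L₂ ; _⟶[_]_ = tr }
  where
  tr : State L₁ ⊎ State L₂ → A → State L₁ ⊎ State L₂ → Set
  tr (inj₁ s) a (inj₁ s') = LTS._⟶[_]_ L₁ s a s'
  tr (inj₂ s) a (inj₂ s') = LTS._⟶[_]_ L₂ s a s'
  tr _        _ _         = ⊥

IsBisimulation : {A : Set} (L : LTS A) → (State L → State L → Set) → Set
IsBisimulation {A} L R =
  (∀ s t → R s t → R t s) ×
  (∀ s t (a : A) s' → R s t → LTS._⟶[_]_ L s a s' →
     ∃ λ t' → LTS._⟶[_]_ L t a t' × R s' t')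

Bisimilar : {A : Set} (L : LTS A) → State L → State L → Set₁
Bisimilar L s t = ∃ λ (R : State L → State L → Set) → IsBisimulation L R × R s t

BisimilarP : {A : Set} → Pointed A → Pointed A → Set₁
BisimilarP (L₁ , s) (L₂ , t) = Bisimilar (L₁ ⊎L L₂) (inj₁ s) (inj₂ t)

finLTS : {A : Set} (n : ℕ) → (Fin n → A → Fin n → Bool) → LTS A
finLTS n δ = record { State = Fin n ; _⟶[_]_ = λ s a t → T (δ s a t) }

data Kind : Set where
  call ret int : Kind

arity : Kind → ℕ
arity call = 2
arity ret  = 0
arity int  = 1

hk : Kind → ℤ
hk call = + 1
hk ret  = - (+ 1)
hk int  = + 0

record Rule (nQ nΓ nA : ℕ) : Set where
  constructor rule
  field
    p : Fin nQ
    X : Fin nΓ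
    a : Fin nA
    q : Fin nQ
    α : List (Fin nΓ)

record VPDA : Set where
  field
    nQ nΓ nA : ℕ
    kind     : Fin nA → Kind
    rules    : List (Rule nQ nΓ nA)
    visibly  : All (λ r → length (Rule.α r) ≡ arity (kind (Rule.a r))) rules
open VPDA public

Config : VPDA → Set
Config M = Fin (nQ M) × List (Fin (nΓ M))

data PStep (M : VPDA) : Config M → Fin (nA M) → Config M → Set where
  apply : ∀ {p X a q α} (γ : List (Fin (nΓ M))) →
          rule p X a q α ∈ rules M →
          PStep M (p , X ∷ γ) a (q , α ++ γ)

pdaLTS : (M : VPDA) → LTS (Fin (nA M))
pdaLTS M = record { State = Config M ; _⟶[_]_ = PStep M }

h : (M : VPDA) → List (Fin (nA M)) → ℤ
h M []      = + 0
h M (a ∷ w) = hk (kind M a) +ℤ h M w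

proc : (M : VPDA) → Fin (nQ M) → Fin (nΓ M) → Pointed (Fin (nA M))
proc M p X = pdaLTS M , (p , X ∷ [])

UnboundedPopping : (M : VPDA) → Fin (nQ M) → Fin (nΓ M) → Set
UnboundedPopping M p X =
  ∀ (d : ℕ) → ∃ λ (c : Config M) → ∃ λ (w : List (Fin (nA M))) →
    (h M w ≤ - (+ d)) × Reach (pdaLTS M) (p , X ∷ []) c × IsTrace (pdaLTS M) c w

Regular : ∀ {ℓ} (M : VPDA) →
          (Pointed (Fin (nA M)) → Pointed (Fin (nA M)) → Set ℓ) →
          Fin (nQ M) → Fin (nΓ M) → Set ℓ
Regular M _≈_ p X =
  ∃ λ (n : ℕ) → ∃ λ (δ : Fin n → Fin (nA M) → Fin n → Bool) → ∃ λ (F : Fin n) →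
    proc M p X ≈ (finLTS n δ , F)

-- If pX pops unboundedly and is trace equivalent to a state of a finite system with n states, then a
-- trace of pX descending n + 1 levels is also a path of the finite system; sampling it at the first
-- visits of the levels 0, -1, …, -n yields a repeated state, i.e. a loop y of negative height after a
-- prefix x. So x yᴷ is a trace of the finite system for every K, whereas pX can run only boundedly many
-- rounds of y after x, since each one removes a stack symbol.
--
-- Conversely, for a depth d abstract configurations by their top d + 1 stack symbols, a finite system.
-- Whether a configuration of full height d + 1, reachable in the abstraction, can empty its stack by
-- steps never exceeding that height is a finite reachability question, hence decidable. If it can, pX
-- pops by d + 1. If not, the truncated bottom of a stack is never inspected, and the abstraction is
-- bisimilar to pX. This dichotomy is the constructive form of "bounded popping implies regularity".

module Submission where

open import Defs
open import Level using (Level; 0ℓ)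
open import Function using (id)
open import Data.Empty using (⊥; ⊥-elim)
open import Data.Bool using (Bool; T; T?)
open import Data.Product using (∃; ∃₂; _×_; _,_; proj₁; proj₂; uncurry)
import Data.Product.Properties as Product
open import Data.Sum using (_⊎_; inj₁; inj₂; [_,_]′)
open import Data.Nat as ℕ using (ℕ; zero; suc; z≤n; s≤s)
import Data.Nat.Properties as ℕ
open import Data.Integer as ℤ using (ℤ; +_; -_; -[1+_]; _+_; _≤_; 0ℤ; 1ℤ; -1ℤ; +≤+; -≤-; -≤+)
import Data.Integer.Properties as ℤ
open import Data.Integer.Tactic.RingSolver using (solve-∀)
open import Data.Fin as Fin using (Fin; toℕ)
open import Data.Fin.Properties using (any?; pigeonhole; remQuot-combine)
open import Data.Fin.Subset using (Subset; ∣_∣; _∪_; ⁅_⁆) renaming (_∈_ to _∈ˢ_; ⊥ to ∅)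
open import Data.Fin.Subset.Properties
  using (_∈?_; ∉⊥; x∈⁅x⁆; x∈⁅y⁆⇒x≡y; p⊆p∪q; q⊆p∪q; x∈p∪q⁻; p⊂q⇒∣p∣<∣q∣; ∣p∣≤n)
open import Data.List using (List; []; _∷_; _++_; length; concat; replicate; take; drop)
open import Data.List.Properties
  using (length-++; ++-assoc; ++-identityʳ; take++drop≡id; take-all; length-take; take-[])
import Data.List.Properties as List
open import Data.List.Membership.Propositional using (_∈_; lose; find)
open import Data.List.Relation.Unary.Any as Any using (Any)
import Data.List.Relation.Unary.All as All
open import Relation.Binary using (Rel; Decidable; IsEquivalence)
open import Relation.Binary.Construct.Closure.ReflexiveTransitive as Star using (Star; ε; _◅_; _◅◅_)
open import Relation.Binary.PropositionalEquality
open import Relation.Nullary using (¬_; Dec; yes; no; contradiction)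
open import Relation.Nullary.Decidable
  using (map′; ¬?; decidable-stable; _×-dec_; _⊎-dec_; isYes; toWitness; fromWitness)

-i+[i+j]≡j : ∀ i j → - i + (i + j) ≡ j
-i+[i+j]≡j = solve-∀

i+[-i+j]≡j : ∀ i j → i + (- i + j) ≡ j
i+[-i+j]≡j = solve-∀

+-shiftˡ-≤ : ∀ i {j k} → i + j ≤ k → j ≤ - i + k
+-shiftˡ-≤ i {j} le = ℤ.≤-trans (ℤ.≤-reflexive (sym (-i+[i+j]≡j i j))) (ℤ.+-monoʳ-≤ (- i) le)

+0≡+n+i⇒i≡-n : ∀ n {i} → + 0 ≡ + n + i → i ≡ - (+ n)
+0≡+n+i⇒i≡-n n {i} eq =
  trans (sym (-i+[i+j]≡j (+ n) i)) (trans (cong (λ k → - (+ n) + k) (sym eq)) (ℤ.+-identityʳ (- (+ n))))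

≤0∧≢0⇒≤-1 : ∀ {z} → z ≤ 0ℤ → z ≢ 0ℤ → z ≤ -1ℤ
≤0∧≢0⇒≤-1 {+ zero}     _        z≢0 = contradiction refl z≢0
≤0∧≢0⇒≤-1 {+ suc _}    (+≤+ ()) _
≤0∧≢0⇒≤-1 { -[1+ _ ]} _        _   = -≤- z≤n

module _ {A : Set} (L : LTS A) where

  steps-++ : ∀ {s u s′ w s″} → Steps L s u s′ → Steps L s′ w s″ → Steps L s (u ++ w) s″
  steps-++ done       q = q
  steps-++ (step t p) q = step t (steps-++ p q)

  steps-split : ∀ u {s w s″} → Steps L s (u ++ w) s″ → ∃ λ s′ → Steps L s u s′ × Steps L s′ w s″
  steps-split []      p          = _ , done , p
  steps-split (a ∷ u) (step t p) with s′ , p₁ , p₂ ← steps-split u p = s′ , step t p₁ , p₂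

  steps-replicate : ∀ K {s y} → Steps L s y s → Steps L s (concat (replicate K y)) s
  steps-replicate zero    p = done
  steps-replicate (suc K) p = steps-++ p (steps-replicate K p)

-- Reachability in finite graphs

module FiniteReachability {N : ℕ} {E : Rel (Fin N) 0ℓ} (E? : Decidable E) (j : Fin N) where

  Within : ℕ → Fin N → Set
  Within zero    i = i ≡ j
  Within (suc k) i = Within k i ⊎ ∃ λ m → E i m × Within k m

  within? : ∀ k i → Dec (Within k i)
  within? zero    i = i Fin.≟ j
  within? (suc k) i = within? k i ⊎-dec any? (λ m → E? i m ×-dec within? k m)

  within⇒star : ∀ k {i} → Within k i → Star E i j
  within⇒star zero    refl              = ε
  within⇒star (suc k) (inj₁ w)          = within⇒star k w
  within⇒star (suc k) (inj₂ (m , e , w)) = e ◅ within⇒star k w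

  star⇒within : ∀ {i} → Star E i j → ∃ λ k → Within k i
  star⇒within ε = zero , refl
  star⇒within (e ◅ s) with k , w ← star⇒within s = suc k , inj₂ (_ , e , w)

  within-mono : ∀ {k k′ i} → k ℕ.≤ k′ → Within k i → Within k′ i
  within-mono {k′ = zero}  z≤n w = w
  within-mono {k′ = suc k′} z≤n w = inj₁ (within-mono z≤n w)
  within-mono (s≤s k≤k′) (inj₁ w)          = inj₁ (within-mono k≤k′ w)
  within-mono (s≤s k≤k′) (inj₂ (m , e , w)) = inj₂ (m , e , within-mono k≤k′ w)

  Stable : ℕ → Set
  Stable k = ∀ i → Within (suc k) i → Within k i

  stable⇒within : ∀ {K} → Stable K → ∀ k {i} → Within k i → Within K i
  stable⇒within st zero    w                  = within-mono z≤n w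
  stable⇒within st (suc k) (inj₁ w)           = stable⇒within st k w
  stable⇒within st (suc k) (inj₂ (m , e , w)) = st _ (inj₂ (m , e , stable⇒within st k w))

  Grows : ℕ → Set
  Grows k = ∃ λ i → Within (suc k) i × ¬ Within k i

  grows? : ∀ k → Dec (Grows k)
  grows? k = any? λ i → within? (suc k) i ×-dec ¬? (within? k i)

  ¬grows⇒stable : ∀ {k} → ¬ Grows k → Stable k
  ¬grows⇒stable {k} ¬g i w with within? k i
  ... | yes w′ = w′
  ... | no ¬w′ = contradiction (i , w , ¬w′) ¬g

  -- Each growing stage adds a new vertex, so the vertices added by N + 1 growing stages collide.
  ¬always-grows : ¬ (∀ (k : Fin (suc N)) → Grows (toℕ k))
  ¬always-grows grows with k , k′ , k<k′ , same ← pigeonhole (ℕ.n<1+n N) (λ k → proj₁ (grows k)) =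
    proj₂ (proj₂ (grows k′))
      (subst (Within (toℕ k′)) same (within-mono k<k′ (proj₁ (proj₂ (grows k)))))

  stable : ∃ Stable
  stable with any? (λ k → ¬? (grows? (toℕ k)))
  ... | yes (k , ¬g) = toℕ k , ¬grows⇒stable ¬g
  ... | no ¬st = ⊥-elim (¬always-grows λ k → decidable-stable (grows? (toℕ k)) (λ ¬g → ¬st (k , ¬g)))

  reaches? : ∀ i → Dec (Star E i j)
  reaches? i = map′ (within⇒star K) (λ s → stable⇒within st _ (proj₂ (star⇒within s))) (within? K i)
    where
    K  = proj₁ stable
    st = proj₂ stable

star? : ∀ {N} {E : Rel (Fin N) 0ℓ} → Decidable E → Decidable (Star E)
star? E? i j = FiniteReachability.reaches? E? j i

-- Stack heights

-1≤hk : ∀ k → -1ℤ ≤ hk k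
-1≤hk call = -≤+
-1≤hk ret  = ℤ.≤-refl
-1≤hk int  = -≤+

arity≡1+hk : ∀ k n → + (arity k ℕ.+ n) ≡ + suc n + hk k
arity≡1+hk call n = cong +_ (ℕ.+-comm 1 (suc n))
arity≡1+hk ret  n = refl
arity≡1+hk int  n = cong +_ (sym (ℕ.+-identityʳ (suc n)))

module Heights (M : VPDA) where

  h-++ : ∀ u w → h M (u ++ w) ≡ h M u + h M w
  h-++ []      w = sym (ℤ.+-identityˡ (h M w))
  h-++ (a ∷ u) w =
    trans (cong (λ x → hk (kind M a) + x) (h-++ u w)) (sym (ℤ.+-assoc (hk (kind M a)) (h M u) (h M w)))

  -- A discrete intermediate value theorem: heights drop by at most one per action.
  split-at-height : ∀ w z → z ≤ 0ℤ → h M w ≤ z → ∃₂ λ u v → w ≡ u ++ v × h M u ≡ z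
  split-at-height []      z z≤0 hw≤z = [] , [] , refl , ℤ.≤-antisym hw≤z z≤0
  split-at-height (a ∷ w) z z≤0 hw≤z with z ℤ.≟ 0ℤ
  ... | yes refl = [] , a ∷ w , refl , refl
  ... | no z≢0
    with u , v , refl , hu ← split-at-height w (- hk (kind M a) + z)
           (ℤ.+-mono-≤ (ℤ.neg-mono-≤ (-1≤hk (kind M a))) (≤0∧≢0⇒≤-1 z≤0 z≢0))
           (+-shiftˡ-≤ (hk (kind M a)) hw≤z)
    = a ∷ u , v , refl , trans (cong (λ x → hk (kind M a) + x) hu) (i+[-i+j]≡j (hk (kind M a)) z)

  height : Config M → ℕ
  height (_ , γ) = length γ

  height-step : ∀ {c a c′} → PStep M c a c′ → + height c′ ≡ + height c + hk (kind M a)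
  height-step (apply {a = a} {α = α} γ r∈) rewrite length-++ α {γ} | All.lookup (visibly M) r∈ =
    arity≡1+hk (kind M a) (length γ)

  height-steps : ∀ {c w c′} → Steps (pdaLTS M) c w c′ → + height c′ ≡ + height c + h M w
  height-steps {c} done = sym (ℤ.+-identityʳ (+ height c))
  height-steps {c} {_} {c′} (step {a = a} {s' = c₁} {w = w} t p) = begin
    + height c′                           ≡⟨ height-steps p ⟩
    + height c₁ + h M w                   ≡⟨ cong (_+ h M w) (height-step t) ⟩
    + height c + hk (kind M a) + h M w    ≡⟨ ℤ.+-assoc (+ height c) (hk (kind M a)) (h M w) ⟩
    + height c + (hk (kind M a) + h M w)  ∎
    where open ≡-Reasoning

  popping-lowers : ∀ {c y c′} → Steps (pdaLTS M) c y c′ → h M y ≤ -1ℤ → height c′ ℕ.< height c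
  popping-lowers {c} {y} {c′} p hy = ℤ.drop‿+≤+ (begin
    1ℤ + + height c′             ≡⟨ cong (λ i → 1ℤ + i) (height-steps p) ⟩
    1ℤ + (+ height c + h M y)    ≤⟨ ℤ.+-monoʳ-≤ 1ℤ (ℤ.+-monoʳ-≤ (+ height c) hy) ⟩
    1ℤ + (+ height c + -1ℤ)      ≡⟨ 1+[i+-1]≡i (+ height c) ⟩
    + height c                   ∎)
    where
    open ℤ.≤-Reasoning
    1+[i+-1]≡i : ∀ i → 1ℤ + (i + -1ℤ) ≡ i
    1+[i+-1]≡i = solve-∀

  replicate-popping-lowers : ∀ K {y c c′} → h M y ≤ -1ℤ → Steps (pdaLTS M) c (concat (replicate K y)) c′ →
                             K ℕ.+ height c′ ℕ.≤ height c
  replicate-popping-lowers zero    hy done = ℕ.≤-refl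
  replicate-popping-lowers (suc K) {y} hy p with c₁ , p₁ , p₂ ← steps-split (pdaLTS M) y p =
    ℕ.≤-trans (s≤s (replicate-popping-lowers K hy p₂)) (popping-lowers p₁ hy)

  -- From c, each round of y pops at least one symbol, but only |height c + h x| remain after x.
  ¬trace-pumped : ∀ {c} x {y} → h M y ≤ -1ℤ →
                  ¬ IsTrace (pdaLTS M) c (x ++ concat (replicate (suc ℤ.∣ + height c + h M x ∣) y))
  ¬trace-pumped {c} x hy (c′ , p) with cx , p₁ , p₂ ← steps-split (pdaLTS M) x p =
    ℕ.<-irrefl refl (ℕ.≤-trans (ℕ.m≤m+n _ (height c′))
      (subst (λ m → suc m ℕ.+ height c′ ℕ.≤ height cx) (sym (cong ℤ.∣_∣ (height-steps p₁)))
             (replicate-popping-lowers _ hy p₂)))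

-- Unbounded popping excludes finite trace-equivalent systems

module NegativeCycle (M : VPDA) {n : ℕ} (δ : Fin n → Fin (nA M) → Fin n → Bool) where
  open Heights M

  Descends : Fin n → Fin n → Set
  Descends v G = ∃ λ u → Steps (finLTS n δ) v u G × h M u ≤ -1ℤ

  descends-extend : ∀ {v G u G′} → Descends v G → Steps (finLTS n δ) G u G′ → h M u ≤ 0ℤ → Descends v G′
  descends-extend (u′ , p′ , hu′) p hu =
    u′ ++ _ , steps-++ _ p′ p , ℤ.≤-trans (ℤ.≤-reflexive (h-++ u′ _)) (ℤ.+-mono-≤ hu′ hu)

  ∣p∣<∣p∪⁅x⁆∣ : ∀ (S : Subset n) {x} → ¬ x ∈ˢ S → ∣ S ∣ ℕ.< ∣ S ∪ ⁅ x ⁆ ∣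
  ∣p∣<∣p∪⁅x⁆∣ S {x} x∉S = p⊂q⇒∣p∣<∣q∣ (p⊆p∪q ⁅ x ⁆ , x , q⊆p∪q S ⁅ x ⁆ (x∈⁅x⁆ x) , x∉S)

  -- Walk along w one unit of depth at a time, collecting in S the states passed so far; each of them
  -- descends to the current state, so revisiting one closes a cycle of negative height.
  negative-cycle : ∀ k (S : Subset n) {F G w G′} → Reach (finLTS n δ) F G → Steps (finLTS n δ) G w G′ →
                   h M w ≤ - (+ k) → n ℕ.< k ℕ.+ ∣ S ∣ → (∀ v → v ∈ˢ S → Descends v G) →
                   ∃ λ H → Reach (finLTS n δ) F H × Descends H H
  negative-cycle zero S _ _ _ n<∣S∣ _ = ⊥-elim (ℕ.<⇒≱ n<∣S∣ (∣p∣≤n S))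
  negative-cycle (suc k) S {G = G} {w} r p hw n<1+k+∣S∣ desc with G ∈? S
  ... | yes G∈S = G , r , desc G G∈S
  ... | no G∉S
    with w₁ , w₂ , refl , hw₁ ← split-at-height w -1ℤ -≤+ (ℤ.≤-trans hw (-≤- z≤n))
    with G₁ , p₁ , p₂ ← steps-split (finLTS n δ) w₁ p =
    negative-cycle k (S ∪ ⁅ G ⁆) (proj₁ r ++ w₁ , steps-++ _ (proj₂ r) p₁) p₂ hw₂
      (ℕ.<-≤-trans n<1+k+∣S∣ (ℕ.+-monoʳ-< k (∣p∣<∣p∪⁅x⁆∣ S G∉S))) desc′
    where
    hw₂ : h M w₂ ≤ - (+ k)
    hw₂ = subst (h M w₂ ≤_) (ℤ.1-[1+n]≡-n k)
            (+-shiftˡ-≤ -1ℤ (subst (_≤ - (+ suc k)) (trans (h-++ w₁ w₂) (cong (_+ h M w₂) hw₁)) hw))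
    desc′ : ∀ v → v ∈ˢ S ∪ ⁅ G ⁆ → Descends v G₁
    desc′ v v∈ with x∈p∪q⁻ S ⁅ G ⁆ v∈
    ... | inj₁ v∈S = descends-extend (desc v v∈S) p₁ (ℤ.≤-trans (ℤ.≤-reflexive hw₁) -≤+)
    ... | inj₂ v∈G rewrite x∈⁅y⁆⇒x≡y G v∈G = w₁ , p₁ , ℤ.≤-reflexive hw₁

unboundedPopping⇒¬traceFinite : ∀ (M : VPDA) p X → UnboundedPopping M p X →
                                ∀ n δ F → ¬ TraceEquivalent (proc M p X) (finLTS n δ , F)
unboundedPopping⇒¬traceFinite M p X up n δ F te
  with c , w , hw , (u , pu) , (c′ , pw) ← up (suc n)
  with G′ , pF ← proj₁ (te (u ++ w)) (c′ , steps-++ _ pu pw)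
  with G , pFu , pFw ← steps-split _ u pF
  with H , (x , px) , (y , py , hy) ← NegativeCycle.negative-cycle M δ (suc n) ∅ (u , pFu) pFw hw
                                        (ℕ.m≤m+n (suc n) _) (λ v v∈∅ → ⊥-elim (∉⊥ v∈∅)) =
  Heights.¬trace-pumped M x {y} hy
    (proj₂ (te _) (H , steps-++ _ px (steps-replicate _ (suc ℤ.∣ 1ℤ + h M x ∣) py)))

-- Bounded popping yields a finite bisimilar system

PopsBy : (M : VPDA) → Fin (nQ M) → Fin (nΓ M) → ℕ → Set
PopsBy M p X d = ∃ λ (c : Config M) → ∃ λ (w : List (Fin (nA M))) →
  (h M w ≤ - (+ d)) × Reach (pdaLTS M) (p , X ∷ []) c × IsTrace (pdaLTS M) c w

module BoundedLists (m : ℕ) where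

  capacity : ℕ → ℕ
  capacity zero    = 1
  capacity (suc k) = suc (m ℕ.* capacity k)

  encode : ∀ k → List (Fin m) → Fin (capacity k)
  encode zero    _        = Fin.zero
  encode (suc k) []       = Fin.zero
  encode (suc k) (x ∷ xs) = Fin.suc (Fin.combine x (encode k xs))

  decode : ∀ k → Fin (capacity k) → List (Fin m)
  decode zero    _           = []
  decode (suc k) Fin.zero    = []
  decode (suc k) (Fin.suc i) = uncurry (λ x i′ → x ∷ decode k i′) (Fin.remQuot (capacity k) i)

  decode-encode : ∀ k xs → decode k (encode k xs) ≡ take k xs
  decode-encode zero    xs       = refl
  decode-encode (suc k) []       = refl
  decode-encode (suc k) (x ∷ xs) =
    trans (cong (uncurry (λ x i′ → x ∷ decode k i′)) (remQuot-combine x (encode k xs)))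
          (cong (x ∷_) (decode-encode k xs))

  length-decode : ∀ k i → length (decode k i) ℕ.≤ k
  length-decode zero    _           = z≤n
  length-decode (suc k) Fin.zero    = z≤n
  length-decode (suc k) (Fin.suc i) = s≤s (length-decode k _)

module Firing (M : VPDA) where
  open Heights M using (height)

  data Fires : Rule (nQ M) (nΓ M) (nA M) → Config M → Config M → Set where
    fire : ∀ {p X a q α} γ → Fires (rule p X a q α) (p , X ∷ γ) (q , α ++ γ)

  fires-det : ∀ {r c c₁ c₂} → Fires r c c₁ → Fires r c c₂ → c₁ ≡ c₂
  fires-det (fire γ) (fire .γ) = refl

  fires⇒step : ∀ {r c c′} → r ∈ rules M → Fires r c c′ → PStep M c (Rule.a r) c′
  fires⇒step r∈ (fire γ) = apply γ r∈

  step⇒fires : ∀ {c a c′} → PStep M c a c′ → ∃ λ r → r ∈ rules M × Rule.a r ≡ a × Fires r c c′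
  step⇒fires (apply γ r∈) = _ , r∈ , refl , fire γ

  fires-from? : ∀ r c → Dec (∃ (Fires r c))
  fires-from? (rule p X a q α) (p′ , [])    = no λ { (_ , ()) }
  fires-from? (rule p X a q α) (p′ , Y ∷ γ) with p′ Fin.≟ p | Y Fin.≟ X
  ... | yes refl | yes refl = yes (_ , fire γ)
  ... | no p′≢p  | _        = no λ { (_ , fire _) → p′≢p refl }
  ... | yes refl | no Y≢X   = no λ { (_ , fire _) → Y≢X refl }

  _≟ᶜ_ : (c c′ : Config M) → Dec (c ≡ c′)
  _≟ᶜ_ = Product.≡-dec Fin._≟_ (List.≡-dec Fin._≟_)

  fires-onto? : (f : Config M → Config M) → ∀ r c c′ → Dec (∃ λ c″ → Fires r c c″ × c′ ≡ f c″)
  fires-onto? f r c c′ with fires-from? r c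
  ... | no ¬fires      = no λ { (c″ , fi , _) → ¬fires (c″ , fi) }
  ... | yes (c″ , fi) =
    map′ (λ e → c″ , fi , e) (λ { (c‴ , fi′ , e) → trans e (cong f (fires-det fi′ fi)) }) (c′ ≟ᶜ f c″)

  fires? : ∀ r c c′ → Dec (Fires r c c′)
  fires? r c c′ = map′ (λ { (_ , fi , refl) → fi }) (λ fi → _ , fi , refl) (fires-onto? id r c c′)

  _≼_ : Config M → Config M → Set
  s ≼ c = proj₁ s ≡ proj₁ c × ∃ λ β → proj₂ s ++ β ≡ proj₂ c

  ≼-refl : ∀ c → c ≼ c
  ≼-refl c = refl , [] , ++-identityʳ (proj₂ c)

  ≼-fires : ∀ {r s s′ c} → s ≼ c → Fires r s s′ → ∃ λ c′ → Fires r c c′ × s′ ≼ c′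
  ≼-fires (refl , β , refl) (fire {α = α} γ) = _ , fire (γ ++ β) , refl , β , ++-assoc α γ β

  ≼-fires⁻ : ∀ {r s c c′} → s ≼ c → height s ≢ 0 → Fires r c c′ → ∃ (Fires r s)
  ≼-fires⁻ {s = q , []}    _                  nonempty _        = contradiction refl nonempty
  ≼-fires⁻ {s = q , Y ∷ γ} (refl , β , refl) _        (fire _) = _ , fire γ

  ≼-steps : ∀ {s w s′ c} → s ≼ c → Steps (pdaLTS M) s w s′ → ∃ λ c′ → Steps (pdaLTS M) c w c′ × s′ ≼ c′
  ≼-steps s≼c done = _ , done , s≼c
  ≼-steps s≼c (step t p)
    with r , r∈ , refl , fi ← step⇒fires t
    with c₁ , fi₁ , s₁≼c₁ ← ≼-fires s≼c fi
    with c′ , p′ , s′≼c′ ← ≼-steps s₁≼c₁ p = c′ , step (fires⇒step r∈ fi₁) p′ , s′≼c′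

module Truncation (M : VPDA) (D : ℕ) where
  open Heights M using (height)
  open Firing M
  open BoundedLists (nΓ M)

  truncate : Config M → Config M
  truncate (q , γ) = q , take D γ

  truncate-≼ : ∀ {s c} → s ≼ c → truncate s ≼ c
  truncate-≼ {q , γ} (refl , β , refl) =
    refl , drop D γ ++ β , trans (sym (++-assoc (take D γ) _ β)) (cong (_++ β) (take++drop≡id D γ))

  truncate-fits : ∀ c → height c ℕ.≤ D → truncate c ≡ c
  truncate-fits (q , γ) fits = cong (q ,_) (take-all D γ fits)

  height-truncate-overflow : ∀ c → ¬ height c ℕ.≤ D → height (truncate c) ≡ D
  height-truncate-overflow (q , γ) overflow = trans (length-take D γ) (ℕ.m≤n⇒m⊓n≡m (ℕ.<⇒≤ (ℕ.≰⇒> overflow)))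

  Size : ℕ
  Size = nQ M ℕ.* capacity D

  config : Fin Size → Config M
  config j = uncurry (λ q i → q , decode D i) (Fin.remQuot (capacity D) j)

  code : Config M → Fin Size
  code (q , γ) = Fin.combine q (encode D γ)

  config-code : ∀ c → config (code c) ≡ truncate c
  config-code (q , γ) = trans (cong (uncurry (λ q i → q , decode D i)) (remQuot-combine q (encode D γ)))
                              (cong (q ,_) (decode-encode D γ))

  height-config : ∀ j → height (config j) ℕ.≤ D
  height-config j = length-decode D (proj₂ (Fin.remQuot {nQ M} (capacity D) j))

  δ : Fin Size → Fin (nA M) → Fin Size → Bool
  δ j a j′ = isYes (Any.any? (λ r → (Rule.a r Fin.≟ a) ×-dec fires-onto? truncate r (config j) (config j′))
                             (rules M))

  δ-intro : ∀ {r j c j′} → r ∈ rules M → Fires r (config j) c → config j′ ≡ truncate c → T (δ j (Rule.a r) j′)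
  δ-intro r∈ fi eq = fromWitness (lose r∈ (refl , _ , fi , eq))

  δ-elim : ∀ {j a j′} → T (δ j a j′) →
           ∃ λ r → r ∈ rules M × Rule.a r ≡ a × ∃ λ c → Fires r (config j) c × config j′ ≡ truncate c
  δ-elim t with r , r∈ , a≡ , fi ← find (toWitness t) = r , r∈ , a≡ , fi

  Edge : Rel (Fin Size) 0ℓ
  Edge j j′ = ∃ λ a → T (δ j a j′)

  edge? : Decidable Edge
  edge? j j′ = any? λ a → T? (δ j a j′)

  -- Steps that stay within height D, taken without truncation.
  ExactEdge : Rel (Fin Size) 0ℓ
  ExactEdge j j′ = Any (λ r → Fires r (config j) (config j′)) (rules M)

  exactEdge? : Decidable ExactEdge
  exactEdge? j j′ = Any.any? (λ r → fires? r (config j) (config j′)) (rules M)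

  exactEdge⇒edge : ∀ {j j′} → ExactEdge j j′ → Edge j j′
  exactEdge⇒edge {j′ = j′} e with r , r∈ , fi ← find e =
    Rule.a r , δ-intro r∈ fi (sym (truncate-fits (config j′) (height-config j′)))

  exactPath⇒steps : ∀ {i j} → Star ExactEdge i j → ∃ λ w → Steps (pdaLTS M) (config i) w (config j)
  exactPath⇒steps ε = [] , done
  exactPath⇒steps (e ◅ π) with r , r∈ , fi ← find e | w , p ← exactPath⇒steps π =
    Rule.a r ∷ w , step (fires⇒step r∈ fi) p

  path-≼ : ∀ {i j c} → Star Edge i j → config i ≼ c → ∃ λ c′ → Reach (pdaLTS M) c c′ × config j ≼ c′
  path-≼ ε i≼c = _ , ([] , done) , i≼c
  path-≼ (( _ , t) ◅ π) i≼c
    with r , r∈ , refl , s′ , fi , eq ← δ-elim t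
    with c₁ , fi₁ , s′≼c₁ ← ≼-fires i≼c fi
    with c′ , (w , p) , j≼c′ ← path-≼ π (subst (_≼ c₁) (sym eq) (truncate-≼ s′≼c₁)) =
    c′ , (Rule.a r ∷ w , step (fires⇒step r∈ fi₁) p) , j≼c′

-- The abstraction keeps the top suc d stack symbols; the bound is positive so that pX itself is represented.
module PopOrFinite (M : VPDA) (p : Fin (nQ M)) (X : Fin (nΓ M)) (d : ℕ) where
  open Heights M
  open Firing M
  open Truncation M (suc d)

  start : Fin Size
  start = code (p , X ∷ [])

  config-start : config start ≡ (p , X ∷ [])
  config-start = trans (config-code _) (cong (λ γ → p , X ∷ γ) (take-[] d))

  Full : Fin Size → Set
  Full j = height (config j) ≡ suc d

  Deep : Fin Size → Set
  Deep j = ∃ λ j₀ → Full j₀ × Star Edge start j₀ × Star ExactEdge j₀ j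

  DeepPop : Set
  DeepPop = ∃ λ j → height (config j) ≡ 0 × Deep j

  deepPop? : Dec DeepPop
  deepPop? = any? λ j → (height (config j) ℕ.≟ 0) ×-dec any? λ j₀ →
    (height (config j₀) ℕ.≟ suc d) ×-dec (star? edge? start j₀ ×-dec star? exactEdge? j₀ j)

  deepPop⇒popsBy : DeepPop → PopsBy M p X d
  deepPop⇒popsBy (j , empty , j₀ , full , π , ρ)
    with c₀ , reach , j₀≼c₀ ← path-≼ π (subst (_≼ (p , X ∷ [])) (sym config-start) (≼-refl _))
    with w , steps ← exactPath⇒steps ρ
    with c′ , steps′ , _ ← ≼-steps j₀≼c₀ steps =
    c₀ , w , hw , reach , c′ , steps′
    where
    hw : h M w ≤ - (+ d)
    hw = begin
      h M w        ≡⟨ +0≡+n+i⇒i≡-n (suc d) (subst₂ (λ m n → + m ≡ + n + h M w) empty full (height-steps steps)) ⟩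
      - (+ suc d)  ≤⟨ ℤ.neg-mono-≤ (+≤+ (ℕ.n≤1+n d)) ⟩
      - (+ d)      ∎
      where open ℤ.≤-Reasoning

  data Tracks (c : Config M) (j : Fin Size) : Set where
    exact : config j ≡ c → Star Edge start j → Tracks c j
    deep  : config j ≼ c → Deep j → Tracks c j

  firing-edge : ∀ {r j s′ j′} → r ∈ rules M → Fires r (config j) s′ → config j′ ≡ truncate s′ → Edge j j′
  firing-edge {r} r∈ fi eq = Rule.a r , δ-intro r∈ fi eq

  overflow-inv : ∀ {s′ c′ j′} → config j′ ≡ truncate s′ → s′ ≼ c′ → ¬ height s′ ℕ.≤ suc d →
                 Star Edge start j′ → Tracks c′ j′
  overflow-inv {s′} eq s′≼c′ ov π =
    deep (subst (_≼ _) (sym eq) (truncate-≼ s′≼c′))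
         (_ , trans (cong height eq) (height-truncate-overflow s′ ov) , π , ε)

  inv-step : ∀ {c j r s′ c′ j′} → Tracks c j → r ∈ rules M → Fires r (config j) s′ → Fires r c c′ →
             config j′ ≡ truncate s′ → Tracks c′ j′
  inv-step {s′ = s′} (exact refl π) r∈ fi fi′ eq with fires-det fi fi′ | height s′ ℕ.≤? suc d
  ... | refl | yes fits = exact (trans eq (truncate-fits s′ fits)) (π ◅◅ firing-edge r∈ fi eq ◅ ε)
  ... | refl | no ov    = overflow-inv eq (≼-refl s′) ov (π ◅◅ firing-edge r∈ fi eq ◅ ε)
  inv-step {s′ = s′} (deep j≼c (j₀ , full , π , ρ)) r∈ fi fi′ eq
    with c₁ , fi₁ , s′≼c₁ ← ≼-fires j≼c fi
    with refl ← fires-det fi₁ fi′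
    with height s′ ℕ.≤? suc d
  ... | yes fits = deep (subst (_≼ _) (sym eq) (truncate-≼ s′≼c₁)) (j₀ , full , π , ρ ◅◅ exact-edge ◅ ε)
    where exact-edge = lose r∈ (subst (Fires _ _) (sym (trans eq (truncate-fits s′ fits))) fi)
  ... | no ov    = overflow-inv eq s′≼c₁ ov (π ◅◅ Star.map exactEdge⇒edge ρ ◅◅ firing-edge r∈ fi eq ◅ ε)

  inv-fires⁻ : ∀ {c j r s′} → Tracks c j → Fires r (config j) s′ → ∃ (Fires r c)
  inv-fires⁻ (exact refl _) fi = _ , fi
  inv-fires⁻ (deep j≼c _)   fi = _ , proj₁ (proj₂ (≼-fires j≼c fi))

  module _ (¬deepPop : ¬ DeepPop) where

    inv-fires : ∀ {c j r c′} → Tracks c j → Fires r c c′ → ∃ (Fires r (config j))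
    inv-fires (exact refl _) fi = _ , fi
    inv-fires (deep j≼c dj)  fi = ≼-fires⁻ j≼c (λ empty → ¬deepPop (_ , empty , dj)) fi

    simulate : ∀ {c j a c′} → Tracks c j → PStep M c a c′ → ∃ λ j′ → T (δ j a j′) × Tracks c′ j′
    simulate inv t with r , r∈ , refl , fi ← step⇒fires t with s′ , fi′ ← inv-fires inv fi =
      code s′ , δ-intro r∈ fi′ (config-code s′) , inv-step inv r∈ fi′ fi (config-code s′)

    simulate⁻ : ∀ {c j a j′} → Tracks c j → T (δ j a j′) → ∃ λ c′ → PStep M c a c′ × Tracks c′ j′
    simulate⁻ inv t with r , r∈ , refl , s′ , fi , eq ← δ-elim t with c′ , fi′ ← inv-fires⁻ inv fi =
      c′ , fires⇒step r∈ fi′ , inv-step inv r∈ fi fi′ eq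

    Related : State (pdaLTS M ⊎L finLTS Size δ) → State (pdaLTS M ⊎L finLTS Size δ) → Set
    Related (inj₁ c) (inj₂ j) = Tracks c j
    Related (inj₂ j) (inj₁ c) = Tracks c j
    Related _        _        = ⊥

    related-bisimulation : IsBisimulation (pdaLTS M ⊎L finLTS Size δ) Related
    related-bisimulation = symmetric , simulation
      where
      symmetric : ∀ s t → Related s t → Related t s
      symmetric (inj₁ c) (inj₂ j) inv = inv
      symmetric (inj₂ j) (inj₁ c) inv = inv
      simulation : ∀ s t a s′ → Related s t → LTS._⟶[_]_ (pdaLTS M ⊎L finLTS Size δ) s a s′ →
                   ∃ λ t′ → LTS._⟶[_]_ (pdaLTS M ⊎L finLTS Size δ) t a t′ × Related s′ t′
      simulation (inj₁ c) (inj₂ j) a (inj₁ c′) inv t with j′ , t′ , inv′ ← simulate inv t = inj₂ j′ , t′ , inv′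
      simulation (inj₂ j) (inj₁ c) a (inj₂ j′) inv t with c′ , t′ , inv′ ← simulate⁻ inv t = inj₁ c′ , t′ , inv′

    bisimilar : BisimilarP (proc M p X) (finLTS Size δ , start)
    bisimilar = Related , related-bisimulation , exact config-start ε

popping-or-finite : ∀ (M : VPDA) p X d →
                    PopsBy M p X d ⊎ ∃ λ n → ∃ λ δ → ∃ λ F → BisimilarP (proc M p X) (finLTS n δ , F)
popping-or-finite M p X d with PopOrFinite.deepPop? M p X d
... | yes dp  = inj₁ (PopOrFinite.deepPop⇒popsBy M p X d dp)
... | no ¬dp = inj₂ (_ , _ , _ , PopOrFinite.bisimilar M p X d ¬dp)

theorem4p5 : ∀ {ℓ : Level} (M : VPDA) (p : Fin (nQ M)) (X : Fin (nΓ M))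
    (_≈_ : Pointed (Fin (nA M)) → Pointed (Fin (nA M)) → Set ℓ) →
    IsEquivalence _≈_ →
    (∀ s t → BisimilarP s t → s ≈ t) →
    (∀ s t → s ≈ t → TraceEquivalent s t) →
    (UnboundedPopping M p X → ¬ Regular M _≈_ p X) ×
    (¬ Regular M _≈_ p X → UnboundedPopping M p X)
theorem4p5 M p X _≈_ _ ∼⇒≈ ≈⇒traces = not-regular , unbounded
  where
  not-regular : UnboundedPopping M p X → ¬ Regular M _≈_ p X
  not-regular up (n , δ , F , pX≈F) = unboundedPopping⇒¬traceFinite M p X up n δ F (≈⇒traces _ _ pX≈F)

  unbounded : ¬ Regular M _≈_ p X → UnboundedPopping M p X
  unbounded ¬regular d =
    [ id , (λ { (n , δ , F , pX∼F) → ⊥-elim (¬regular (n , δ , F , ∼⇒≈ _ _ pX∼F)) }) ]′ (popping-or-finite M p X d)
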